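{- Let $G$ be a connected graph of order $n_1$ and let $n_2\ge 2$ be an integer. If $n_1>n_2$, then $pd(G\odot N_{n_2})\ge n_2+1$.
   Context: $N_{n_2}$ is the empty graph of order $n_2$ ($n_2$ isolated vertices, no edges). For a connected graph $F$ and an ordered partition $\Pi=\{P_1,\dots,P_t\}$ of $V(F)$, $r(v|\Pi)=(d(v,P_1),\dots,d(v,P_t))$ where $d$ is shortest-path distance and $d(v,P_i)=\min_{u\in P_i}d(v,u)$; $\Pi$ is a resolving partition if $r(u|\Pi)\ne r(v|\Pi)$ for all distinct vertices $u,v$; $pd(F)$ is the minimum number of sets in a resolving partition. For graphs $G$ of order $n_1$ (vertices $v_1,\dots,v_{n_1}$) and $H$, the corona product $G\odot H$ is obtained from one copy of $G$ and $n_1$ copies $H_1,\dots,H_{n_1}$ of $H$ by joining $v_i$ to every vertex of $H_i$. -}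

module Defs where

open import Data.Nat using (ℕ; zero; suc; _≤_)
open import Data.Fin using (Fin)
open import Data.Sum using (_⊎_; inj₁; inj₂)
open import Data.Product using (_×_; _,_; Σ; ∃)
open import Data.Empty using (⊥)
open import Relation.Binary.PropositionalEquality using (_≡_; _≢_)
open import Relation.Nullary using (¬_)

record Graph (V : Set) : Set₁ where
  field
    Adj     : V → V → Set
    sym     : ∀ {u v} → Adj u v → Adj v u
    irrefl  : ∀ {u} → ¬ Adj u u
open Graph public

data Walk {V : Set} (F : Graph V) : V → V → ℕ → Set where
  here : ∀ {u} → Walk F u u zero
  step : ∀ {u w v k} → Adj F u w → Walk F w v k → Walk F u v (suc k)

Connected : {V : Set} → Graph V → Set
Connected F = ∀ u v → ∃ λ k → Walk F u v k

Dist : {V : Set} → Graph V → V → V → ℕ → Set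
Dist F u v d = Walk F u v d × (∀ k → Walk F u v k → d ≤ k)

-- Ordered partition into t classes P_1..P_t (P_i = class ⁻¹ i), all nonempty.
record OrdPartition (V : Set) (t : ℕ) : Set where
  field
    class    : V → Fin t
    nonempty : ∀ i → ∃ λ u → class u ≡ i
open OrdPartition public

SetDist : {V : Set} {t : ℕ} → Graph V → OrdPartition V t → V → Fin t → ℕ → Set
SetDist F Π v i d =
  (∃ λ u → class Π u ≡ i × Dist F v u d)
  × (∀ u → class Π u ≡ i → ∀ k → Dist F v u k → d ≤ k)

-- Π is resolving: distinct vertices have distinct representations r(·|Π),
-- i.e. they differ in some coordinate d(·,P_i).
Resolving : {V : Set} {t : ℕ} → Graph V → OrdPartition V t → Set
Resolving F Π = ∀ u v → u ≢ v →
  ∃ λ i → Σ ℕ λ d → Σ ℕ λ d' → SetDist F Π u i d × SetDist F Π v i d' × d ≢ d'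

-- "pd(F) ≥ m": every resolving partition of F has at least m classes.
PdAtLeast : {V : Set} → Graph V → ℕ → Set
PdAtLeast {V} F m = ∀ t (Π : OrdPartition V t) → Resolving F Π → m ≤ t

EmptyGraph : (n : ℕ) → Graph (Fin n)
EmptyGraph n = record { Adj = λ _ _ → ⊥ ; sym = λ () ; irrefl = λ () }

-- Corona product G ⊙ H: vertices inj₁ a (copy of G) and inj₂ (a , x)
-- (vertex x of the copy H_a); a is joined to every vertex of H_a.
CoronaAdj : {V W : Set} → Graph V → Graph W → (V ⊎ (V × W)) → (V ⊎ (V × W)) → Set
CoronaAdj G H (inj₁ a) (inj₁ b) = Adj G a b
CoronaAdj G H (inj₁ a) (inj₂ (b , y)) = a ≡ b
CoronaAdj G H (inj₂ (a , x)) (inj₁ b) = a ≡ b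
CoronaAdj G H (inj₂ (a , x)) (inj₂ (b , y)) = a ≡ b × Adj H x y

corona : {V W : Set} → Graph V → Graph W → Graph (V ⊎ (V × W))
corona {V} {W} G H = record { Adj = CoronaAdj G H ; sym = λ {u} {v} → s {u} {v} ; irrefl = λ {u} → ir {u} }
  where
  open import Relation.Binary.PropositionalEquality using () renaming (sym to ≡sym)
  s : ∀ {u v} → CoronaAdj G H u v → CoronaAdj G H v u
  s {inj₁ a} {inj₁ b} p = Graph.sym G p
  s {inj₁ a} {inj₂ _} p = ≡sym p
  s {inj₂ _} {inj₁ b} p = ≡sym p
  s {inj₂ _} {inj₂ _} (p , q) = ≡sym p , Graph.sym H q
  ir : ∀ {u} → ¬ CoronaAdj G H u u
  ir {inj₁ a} p = Graph.irrefl G p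
  ir {inj₂ _} (_ , q) = Graph.irrefl H q

-- Suppose Π is a resolving partition of G ⊙ N_{n₂} with t ≤ n₂ classes.
-- The argument rests on two facts valid in every graph:
--   * a pendant vertex u with neighbour a satisfies d(u,P) = 1 + d(a,P) for
--     every class P not containing u; hence two pendant vertices with the same
--     neighbour and the same class have the same representation;
--   * if every class meets the neighbourhood of a vertex a, then d(a,P) is 0
--     or 1 according to whether a ∈ P; hence two such vertices in the same
--     class have the same representation.
-- In the corona, the n₂ vertices of a copy H_a are pendant at a, so by the
-- first fact they lie in pairwise distinct classes; as t ≤ n₂ they meet every
-- class, so each vertex a of G satisfies the hypothesis of the second fact.
-- Since n₁ > n₂ ≥ t, two vertices of G share a class (pigeonhole), and the
-- second fact says Π does not resolve them: a contradiction.
module Submission where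

open import Defs hiding (sym)
open import Data.Nat using (ℕ; zero; suc; _≤_; _<_; _≤?_; z≤n; s≤s; s≤s⁻¹)
open import Data.Nat.Properties using (≤-antisym; n≤0⇒n≡0; ≤-<-trans; ≰⇒>; <-irrefl)
open import Data.Fin using (Fin; punchOut)
open import Data.Fin.Properties using (_≟_; any?; injective⇒≤; punchOut-injective; pigeonhole; <⇒≢)
open import Data.Sum using (_⊎_; inj₁; inj₂)
open import Data.Product using (_×_; _,_; ∃; proj₁; proj₂)
open import Data.Empty using (⊥; ⊥-elim)
open import Relation.Binary.PropositionalEquality using (_≡_; _≢_; refl; sym; trans; cong)
open import Relation.Nullary using (¬_; yes; no)

injective⇒surjective : ∀ {n m} (f : Fin n → Fin m) → (∀ {x y} → f x ≡ f y → x ≡ y) →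
                       m ≤ n → ∀ j → ∃ λ x → f x ≡ j
injective⇒surjective {n} {suc m} f f-inj m≤n j with any? (λ x → f x ≟ j)
... | yes hit = hit
... | no miss = ⊥-elim (<-irrefl refl (≤-<-trans (injective⇒≤ g-inj) m≤n))
  where
  -- Missing j, f factors injectively through Fin m, forcing n ≤ m.
  avoids : ∀ x → j ≢ f x
  avoids x e = miss (x , sym e)
  g : Fin n → Fin m
  g x = punchOut (avoids x)
  g-inj : ∀ {x y} → g x ≡ g y → x ≡ y
  g-inj {x} {y} e = f-inj (punchOut-injective (avoids x) (avoids y) e)

Pendant : {V : Set} → Graph V → V → V → Set
Pendant F u a = Adj F u a × (∀ {w} → Adj F u w → w ≡ a)

module Resolution {V : Set} (F : Graph V) {t : ℕ} (Π : OrdPartition V t) where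

  SameProfile : V → V → Set
  SameProfile x y = ∀ j {e e'} → SetDist F Π x j e → SetDist F Π y j e' → e ≡ e'

  resolving⇒distinctProfiles : Resolving F Π → ∀ {x y} → x ≢ y → ¬ SameProfile x y
  resolving⇒distinctProfiles res x≢y same with res _ _ x≢y
  ... | j , d , d' , dist , dist' , d≢d' = d≢d' (same j dist dist')

  setDist-unique : ∀ {v j d d'} → SetDist F Π v j d → SetDist F Π v j d' → d ≡ d'
  setDist-unique ((w , cw , dw) , min) ((w' , cw' , dw') , min') =
    ≤-antisym (min w' cw' _ dw') (min' w cw _ dw)

  walk-zero : ∀ {u w} → Walk F u w 0 → u ≡ w
  walk-zero here = refl

  dist-self : ∀ v → Dist F v v 0
  dist-self v = here , λ _ _ → z≤n

  dist-adj : ∀ {v w} → v ≢ w → Adj F v w → Dist F v w 1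
  dist-adj v≢w vw = step vw here , at-least-one
    where
    at-least-one : ∀ k → Walk F _ _ k → 1 ≤ k
    at-least-one zero wk = ⊥-elim (v≢w (walk-zero wk))
    at-least-one (suc k) _ = s≤s z≤n

  different-class : ∀ {v w} → class Π v ≢ class Π w → v ≢ w
  different-class c≢ refl = c≢ refl

  setDist-member : ∀ {v j d} → class Π v ≡ j → SetDist F Π v j d → d ≡ 0
  setDist-member {v} cv (_ , min) = n≤0⇒n≡0 (min v cv 0 (dist-self v))

  walk-into-class : ∀ {v w j k} → class Π v ≢ j → class Π w ≡ j → Walk F v w k → 1 ≤ k
  walk-into-class cv cw here = ⊥-elim (cv cw)
  walk-into-class cv cw (step _ _) = s≤s z≤n

  setDist-neighbour : ∀ {v w j d} → class Π v ≢ j → Adj F v w → class Π w ≡ j →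
                      SetDist F Π v j d → d ≡ 1
  setDist-neighbour cv vw cw ((_ , cx , walk , _) , min) =
    ≤-antisym (min _ cw 1 (dist-adj (different-class (λ e → cv (trans e cw))) vw))
              (walk-into-class cv cx walk)

  module _ {u a : V} (pendant : Pendant F u a) where
    private
      edge : Adj F u a
      edge = proj₁ pendant
      only : ∀ {w} → Adj F u w → w ≡ a
      only = proj₂ pendant

    walk-via-neighbour : ∀ {w k} → Walk F u w (suc k) → Walk F a w k
    walk-via-neighbour (step uw walk) with only uw
    ... | refl = walk

    dist-via-neighbour : ∀ {w k} → u ≢ w → Dist F a w k → Dist F u w (suc k)
    dist-via-neighbour u≢w (walk , min) = step edge walk , longer
      where
      longer : ∀ m → Walk F u _ m → suc _ ≤ m
      longer zero wk = ⊥-elim (u≢w (walk-zero wk))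
      longer (suc m) wk = s≤s (min m (walk-via-neighbour wk))

    dist-from-neighbour : ∀ {w k} → Dist F u w (suc k) → Dist F a w k
    dist-from-neighbour (walk , min) =
      walk-via-neighbour walk , λ m wk → s≤s⁻¹ (min (suc m) (step edge wk))

    setDist-pendant : ∀ {j d} → class Π u ≢ j → SetDist F Π u j d →
                      ∃ λ e → d ≡ suc e × SetDist F Π a j e
    setDist-pendant {d = zero} cu ((w , cw , walk , _) , _) with walk-into-class cu cw walk
    ... | ()
    setDist-pendant {d = suc _} cu ((w , cw , dist) , min) =
      _ , refl , (w , cw , dist-from-neighbour dist) , λ w' cw' k d' →
        s≤s⁻¹ (min w' cw' (suc k) (dist-via-neighbour (different-class (λ e → cu (trans e cw'))) d'))

  pendant-twins : ∀ {u v a} → Pendant F u a → Pendant F v a → class Π u ≡ class Π v →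
                  SameProfile u v
  pendant-twins {u} pu pv cuv j du dv with class Π u ≟ j
  ... | yes cu = trans (setDist-member cu du) (sym (setDist-member (trans (sym cuv) cu) dv))
  ... | no cu with setDist-pendant pu cu du | setDist-pendant pv (λ e → cu (trans cuv e)) dv
  ...   | e , refl , da | e' , refl , da' = cong suc (setDist-unique da da')

  SeesAllClasses : V → Set
  SeesAllClasses a = ∀ j → ∃ λ w → Adj F a w × class Π w ≡ j

  -- Such a vertex is at distance 0 from its own class and 1 from all others.
  seesAll-profile : ∀ {a b} → SeesAllClasses a → SeesAllClasses b → class Π a ≡ class Π b →
                    SameProfile a b
  seesAll-profile {a} sa sb cab j da db with class Π a ≟ j
  ... | yes ca = trans (setDist-member ca da) (sym (setDist-member (trans (sym cab) ca) db))
  ... | no ca with sa j | sb j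
  ...   | w , aw , cw | w' , bw' , cw' =
    trans (setDist-neighbour ca aw cw da) (sym (setDist-neighbour (λ e → ca (trans cab e)) bw' cw' db))

module Corona {V : Set} (G : Graph V) (n : ℕ) where

  leaf-pendant : ∀ a x → Pendant (corona G (EmptyGraph n)) (inj₂ (a , x)) (inj₁ a)
  leaf-pendant a x = refl , only-hub
    where
    only-hub : ∀ {w} → Adj (corona G (EmptyGraph n)) (inj₂ (a , x)) w → w ≡ inj₁ a
    only-hub {inj₁ b} refl = refl
    only-hub {inj₂ _} (_ , ())

  module _ {t : ℕ} (Π : OrdPartition (V ⊎ (V × Fin n)) t)
           (res : Resolving (corona G (EmptyGraph n)) Π) where
    open Resolution (corona G (EmptyGraph n)) Π

    leaf-classes-injective : ∀ a {x y} → class Π (inj₂ (a , x)) ≡ class Π (inj₂ (a , y)) → x ≡ y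
    leaf-classes-injective a {x} {y} cxy with x ≟ y
    ... | yes x≡y = x≡y
    ... | no x≢y = ⊥-elim (resolving⇒distinctProfiles res leaves-differ
                            (pendant-twins (leaf-pendant a x) (leaf-pendant a y) cxy))
      where
      leaves-differ : inj₂ (a , x) ≢ inj₂ (a , y)
      leaves-differ refl = x≢y refl

    hub-sees-all : t ≤ n → ∀ a → SeesAllClasses (inj₁ a)
    hub-sees-all t≤n a j with injective⇒surjective (λ x → class Π (inj₂ (a , x)))
                                                   (leaf-classes-injective a) t≤n j
    ... | x , cx = inj₂ (a , x) , refl , cx

corollary15 : (n₁ n₂ : ℕ) (G : Graph (Fin n₁)) → Connected G → 2 ≤ n₂ → n₂ < n₁ →
    PdAtLeast (corona G (EmptyGraph n₂)) (suc n₂)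
corollary15 n₁ n₂ G _ _ n₂<n₁ t Π res with t ≤? n₂
... | no t≰n₂ = ≰⇒> t≰n₂
... | yes t≤n₂ with pigeonhole (≤-<-trans t≤n₂ n₂<n₁) (λ a → class Π (inj₁ a))
...   | a , b , a<b , cab =
  ⊥-elim (resolving⇒distinctProfiles res hubs-differ
            (seesAll-profile (hub-sees-all Π res t≤n₂ a) (hub-sees-all Π res t≤n₂ b) cab))
  where
  open Resolution (corona G (EmptyGraph n₂)) Π
  open Corona G n₂
  hubs-differ : inj₁ a ≢ inj₁ b
  hubs-differ refl = <⇒≢ a<b refl
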